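{- Let $k\ge 2$ and let $n_1\ge n_2\ge \dots\ge n_k$ be positive integers. Let $K_{n_1,n_2,\dots,n_k}$ be the complete $k$-partite graph with $n_i$ vertices in the $i$-th part, and let $N=\sum_{i=1}^k n_i$. Then $$S(K_{n_1,n_2,\dots,n_k})=2N-n_1-n_2-1.$$
   Context: For a finite simple graph $G=(V,E)$ and an injective map $f:V\to\mathbb Z$, let $\sigma(G,f)=\{f(v)+f(w): vw\in E\}$. The sum index of $G$ is $S(G)=\min_{f}|\sigma(G,f)|$, the minimum over all injective maps $f:V\to\mathbb Z$. -}

module Defs where

open import Data.Nat using (ℕ; _≤_; _∸_; _+_; _*_)
open import Data.Integer using (ℤ) renaming (_+_ to _+ℤ_)
open import Data.Fin using (Fin)
open import Data.Empty using (⊥)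
open import Data.Product using (Σ; ∃; ∃-syntax; _×_; _,_)
open import Data.List using (List; length; map; allFin)
open import Data.Nat.ListAction using (sum)
open import Data.List.Relation.Unary.Unique.Propositional using (Unique)
open import Data.List.Membership.Propositional using (_∈_)
open import Relation.Binary.PropositionalEquality using (_≡_; _≢_)
open import Function.Definitions using (Injective)
open import Function.Bundles using (_⇔_)

-- A simple graph: a vertex type V with a symmetric, irreflexive
-- adjacency relation.  The edge vw ∈ E is represented by Adj v w
-- (equivalently Adj w v).
record Graph : Set₁ where
  field
    V      : Set
    Adj    : V → V → Set
    sym    : ∀ {v w} → Adj v w → Adj w v
    irrefl : ∀ {v} → Adj v v → ⊥

open Graph public

_∈σ[_,_] : ℤ → (G : Graph) → (V G → ℤ) → Set
z ∈σ[ G , f ] = ∃[ v ] ∃[ w ] (Adj G v w × f v +ℤ f w ≡ z)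

SumSetSize : (G : Graph) → (V G → ℤ) → ℕ → Set
SumSetSize G f m =
  Σ (List ℤ) λ L → Unique L × length L ≡ m × (∀ z → (z ∈ L) ⇔ (z ∈σ[ G , f ]))

SumIndexIs : Graph → ℕ → Set
SumIndexIs G s =
  (Σ (V G → ℤ) λ f → Injective _≡_ _≡_ f × SumSetSize G f s)
  × (∀ (f : V G → ℤ) → Injective _≡_ _≡_ f → ∀ m → SumSetSize G f m → s ≤ m)

completeMultipartite : (k : ℕ) → (Fin k → ℕ) → Graph
completeMultipartite k n = record
  { V      = Σ (Fin k) (λ i → Fin (n i))
  ; Adj    = λ { (i , _) (j , _) → i ≢ j }
  ; sym    = λ i≢j j≡i → i≢j (Relation.Binary.PropositionalEquality.sym j≡i)
  ; irrefl = λ i≢i → i≢i Relation.Binary.PropositionalEquality.refl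
  }

totalSize : (k : ℕ) → (Fin k → ℕ) → ℕ
totalSize k n = sum (map n (allFin k))

{-# OPTIONS --safe #-}
module Submission where

-- Write n₀ ≥ n₁ for the two largest part sizes (parts indexed from zero).
-- Lower bound: let u minimise f and let y maximise f over the neighbours of u.
-- The sums f u + f z over the neighbours z of u are all at most f u + f y, while
-- the sums f y + f z over the neighbours z ≠ u of y all exceed it; this gives
-- deg u + deg y − 1 distinct sums.  A vertex of part i has degree N − nᵢ, and
-- u, y lie in different parts, so |σ| ≥ 2N − n₀ − n₁ − 1.
-- Upper bound: label part 1 by n₀, …, n₀ + n₁ − 1, the parts 2, …, k − 1 by the
-- following integers up to N − 1, and part 0 by N, …, N + n₀ − 1.  Every edge has
-- an endpoint outside part 1 and one outside part 0, so all edge sums lie in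
-- [2n₀ + n₁, 2N + n₀ − 2].

open import Defs hiding (sym)
open import Data.Nat using (ℕ; zero; suc; _≤_; _<_; _+_; _*_; _∸_; z≤n; s≤s; s≤s⁻¹)
open import Data.Nat.Properties
open import Data.Nat.ListAction using (sum)
open import Data.Nat.Tactic.RingSolver using (solve-∀)
open import Data.Integer as ℤ using (ℤ)
import Data.Integer.Properties as ℤ
open import Algebra.Properties.AbelianGroup ℤ.+-0-abelianGroup using (∙-cancelˡ)
open import Data.Fin as Fin using (Fin; zero; suc; toℕ; fromℕ<) renaming (_≤_ to _≤ᶠ_)
import Data.Fin.Properties as Fin
open import Data.List
  using (List; []; _∷_; [_]; _++_; length; map; filter; concat; concatMap; upTo; allFin)
import Data.List.Properties as List
open import Data.List.Relation.Unary.Any as Any using (Any; here; there)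
import Data.List.Relation.Unary.All as All
import Data.List.Relation.Unary.All.Properties as All
open import Data.List.Relation.Unary.AllPairs as AllPairs using (_∷_)
import Data.List.Relation.Unary.AllPairs.Properties as AllPairs
open import Data.List.Relation.Unary.Unique.Propositional using (Unique)
import Data.List.Relation.Unary.Unique.Propositional.Properties as Unique
open import Data.List.Membership.Propositional using (_∈_; lose)
open import Data.List.Membership.Propositional.Properties
open import Data.List.Relation.Binary.Subset.Propositional using (_⊆_)
open import Data.List.Relation.Binary.Disjoint.Propositional using (Disjoint)
import Data.List.Extrema ℤ.≤-totalOrder as Extrema
open import Data.Product using (∃; ∃₂; _×_; _,_; proj₁; proj₂)
open import Data.Sum as Sum using (_⊎_; inj₁; inj₂)
open import Data.Empty using (⊥; ⊥-elim)
open import Function using (_∘_; id)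
open import Function.Bundles using (mk⇔; Equivalence)
open import Function.Definitions using (Injective)
open import Relation.Nullary using (¬_; Dec; yes; no; ¬?; contradiction)
open import Relation.Nullary.Decidable using (_×-dec_; map′; decidable-stable)
open import Relation.Unary using (Decidable)
open import Relation.Unary.Properties using (∁?)
open import Relation.Binary.PropositionalEquality
  using (_≡_; _≢_; refl; sym; trans; cong; cong₂; subst; subst₂; module ≡-Reasoning)

module _ {A : Set} where

  ∈-++-∷⁻ : ∀ {x z : A} ys₁ {ys₂} → z ∈ ys₁ ++ x ∷ ys₂ → z ≢ x → z ∈ ys₁ ++ ys₂
  ∈-++-∷⁻ ys₁ z∈ z≢x with ∈-++⁻ ys₁ z∈
  ... | inj₁ z∈ys₁ = ∈-++⁺ˡ z∈ys₁
  ... | inj₂ (here z≡x) = contradiction z≡x z≢x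
  ... | inj₂ (there z∈ys₂) = ∈-++⁺ʳ ys₁ z∈ys₂

  Unique⊆⇒length≤ : ∀ {xs ys : List A} → Unique xs → xs ⊆ ys → length xs ≤ length ys
  Unique⊆⇒length≤ {[]} _ _ = z≤n
  Unique⊆⇒length≤ {x ∷ xs} (x∉xs ∷ xs!) x∷xs⊆ys
    with ys₁ , ys₂ , refl ← ∈-∃++ (x∷xs⊆ys (here refl)) = begin
      suc (length xs)             ≤⟨ s≤s (Unique⊆⇒length≤ xs! xs⊆ys₁++ys₂) ⟩
      suc (length (ys₁ ++ ys₂))   ≡⟨ cong suc (List.length-++ ys₁) ⟩
      suc (length ys₁ + length ys₂) ≡⟨ +-suc (length ys₁) (length ys₂) ⟨
      length ys₁ + suc (length ys₂) ≡⟨ List.length-++ ys₁ ⟨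
      length (ys₁ ++ x ∷ ys₂)     ∎
    where
    open ≤-Reasoning
    xs⊆ys₁++ys₂ : xs ⊆ ys₁ ++ ys₂
    xs⊆ys₁++ys₂ z∈xs =
      ∈-++-∷⁻ ys₁ (x∷xs⊆ys (there z∈xs)) (λ z≡x → All.lookup x∉xs z∈xs (sym z≡x))

  module _ {P : A → Set} (P? : Decidable P) where

    length-filter+length-filter-∁ : ∀ xs →
      length (filter P? xs) + length (filter (∁? P?) xs) ≡ length xs
    length-filter+length-filter-∁ [] = refl
    length-filter+length-filter-∁ (x ∷ xs) with P? x
    ... | yes _ = cong suc (length-filter+length-filter-∁ xs)
    ... | no _ = trans (+-suc _ _) (cong suc (length-filter+length-filter-∁ xs))

    length≤length-filter+length : ∀ {xs ys} → Unique xs →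
      (∀ {x} → x ∈ xs → ¬ P x → x ∈ ys) → length xs ≤ length (filter P? xs) + length ys
    length≤length-filter+length {xs} {ys} xs! rest⊆ys = begin
      length xs                                          ≡⟨ length-filter+length-filter-∁ xs ⟨
      length (filter P? xs) + length (filter (∁? P?) xs) ≤⟨ +-monoʳ-≤ _ (Unique⊆⇒length≤ rest! rest⊆) ⟩
      length (filter P? xs) + length ys                  ∎
      where
      open ≤-Reasoning
      rest! : Unique (filter (∁? P?) xs)
      rest! = Unique.filter⁺ (∁? P?) xs!
      rest⊆ : filter (∁? P?) xs ⊆ ys
      rest⊆ x∈ = let x∈xs , ¬Px = ∈-filter⁻ (∁? P?) x∈ in rest⊆ys x∈xs ¬Px

length-concat : ∀ {A : Set} (xss : List (List A)) →
                length (concat xss) ≡ sum (map length xss)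
length-concat [] = refl
length-concat (xs ∷ xss) = trans (List.length-++ xs) (cong (length xs +_) (length-concat xss))

a+[b+suc[m∸a∸b∸1]]≡m : ∀ a b {m} → a + (b + 1) ≤ m → a + (b + suc (m ∸ a ∸ b ∸ 1)) ≡ m
a+[b+suc[m∸a∸b∸1]]≡m zero zero {suc m} _ = refl
a+[b+suc[m∸a∸b∸1]]≡m zero (suc b) {suc m} (s≤s le) =
  cong suc (a+[b+suc[m∸a∸b∸1]]≡m zero b le)
a+[b+suc[m∸a∸b∸1]]≡m (suc a) b {suc m} (s≤s le) =
  cong suc (a+[b+suc[m∸a∸b∸1]]≡m a b le)

interval : ℕ → ℕ → List ℤ
interval lo s = map (λ t → ℤ.+ (lo + t)) (upTo s)

interval! : ∀ lo s → Unique (interval lo s)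
interval! lo s = Unique.map⁺ (+-cancelˡ-≡ lo _ _ ∘ ℤ.+-injective) (Unique.upTo⁺ s)

length-interval : ∀ lo s → length (interval lo s) ≡ s
length-interval lo s = trans (List.length-map _ (upTo s)) (List.length-upTo s)

∈-interval⁺ : ∀ {lo s x} → lo ≤ x → x < lo + s → ℤ.+ x ∈ interval lo s
∈-interval⁺ {lo} {s} {x} lo≤x x<lo+s =
  subst (λ y → ℤ.+ y ∈ interval lo s) (m+[n∸m]≡n lo≤x)
    (∈-map⁺ _ (∈-upTo⁺ (subst (x ∸ lo <_) (m+n∸m≡n lo s) (∸-monoˡ-< x<lo+s lo≤x))))

SumIndexIs-intro : ∀ {G s} (f : V G → ℤ) → Injective _≡_ _≡_ f → ∀ {m} → m ≤ s →
                   SumSetSize G f m →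
                   (∀ f → Injective _≡_ _≡_ f → ∀ m → SumSetSize G f m → s ≤ m) →
                   SumIndexIs G s
SumIndexIs-intro {G} f f-inj {m} m≤s |σ|≡m lower =
  (f , f-inj , subst (SumSetSize G f) (≤-antisym m≤s (lower f f-inj m |σ|≡m)) |σ|≡m) , lower

module FiniteGraph (G : Graph) (vertices : List (V G)) (∈-vertices : ∀ v → v ∈ vertices)
                   (vertices! : Unique vertices) (Adj? : ∀ v w → Dec (Adj G v w))
                   where

  neighbours : V G → List (V G)
  neighbours v = filter (Adj? v) vertices

  degree : V G → ℕ
  degree v = length (neighbours v)

  ∈-neighbours⁺ : ∀ {u v} → Adj G u v → v ∈ neighbours u
  ∈-neighbours⁺ {u} {v} = ∈-filter⁺ (Adj? u) (∈-vertices v)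

  ∈-neighbours⁻ : ∀ {u v} → v ∈ neighbours u → Adj G u v
  ∈-neighbours⁻ {u} = proj₂ ∘ ∈-filter⁻ (Adj? u) {xs = vertices}

  neighbours! : ∀ v → Unique (neighbours v)
  neighbours! v = Unique.filter⁺ (Adj? v) vertices!

  _∈σ?_ : (z : ℤ) (f : V G → ℤ) → Dec (z ∈σ[ G , f ])
  z ∈σ? f = map′ satisfied₂ (λ (v , w , p) → lose (∈-vertices v) (lose (∈-vertices w) p))
    (Any.any? (λ v → Any.any? (λ w → Adj? v w ×-dec (f v ℤ.+ f w ℤ.≟ z)) vertices) vertices)
    where
    satisfied₂ : Any (λ v → Any (λ w → Adj G v w × f v ℤ.+ f w ≡ z) vertices) vertices →
                 z ∈σ[ G , f ]
    satisfied₂ p = let v , q = Any.satisfied p ; w , r = Any.satisfied q in v , w , r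

  degree+degree≤1+sumSetSize : (f : V G → ℤ) → Injective _≡_ _≡_ f → ∀ {m} → SumSetSize G f m →
    ∀ {u y} → (∀ v → f u ℤ.≤ f v) → (∀ {v} → Adj G u v → f v ℤ.≤ f y) →
    degree u + degree y ≤ suc m
  degree+degree≤1+sumSetSize f f-inj (L , _ , refl , L⇔σ) {u} {y} u-min y-max = begin
    degree u + degree y            ≤⟨ +-monoʳ-≤ (degree u) degree-y≤ ⟩
    degree u + (length Ny + 1)     ≡⟨ +-assoc (degree u) (length Ny) 1 ⟨
    degree u + length Ny + 1       ≡⟨ cong₂ (λ a b → a + b + 1) (List.length-map _ (neighbours u))
                                                                (List.length-map _ Ny) ⟨
    length Su + length Sy + 1      ≡⟨ cong (_+ 1) (List.length-++ Su) ⟨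
    length (Su ++ Sy) + 1          ≤⟨ +-monoˡ-≤ 1 (Unique⊆⇒length≤ sums! sums⊆L) ⟩
    length L + 1                   ≡⟨ +-comm (length L) 1 ⟩
    suc (length L)                 ∎
    where
    open ≤-Reasoning
    above-u? : ∀ z → Dec (f u ℤ.< f z)
    above-u? z = f u ℤ.<? f z
    Ny = filter above-u? (neighbours y)
    Su = map (λ z → f u ℤ.+ f z) (neighbours u)
    Sy = map (λ z → f y ℤ.+ f z) Ny

    degree-y≤ : degree y ≤ length Ny + 1
    degree-y≤ = length≤length-filter+length above-u? {ys = [ u ]} (neighbours! y)
      (λ {z} _ fu≮fz → here (f-inj (ℤ.≤-antisym (ℤ.≮⇒≥ fu≮fz) (u-min z))))

    Su<Sy : ∀ {a} → a ∈ Su → ∀ {b} → b ∈ Sy → a ℤ.< b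
    Su<Sy a∈ b∈ with z , z∈ , refl ← ∈-map⁻ _ a∈ | z′ , z′∈ , refl ← ∈-map⁻ _ b∈ =
      ℤ.≤-<-trans (ℤ.+-monoʳ-≤ (f u) (y-max (∈-neighbours⁻ z∈)))
        (subst (ℤ._< f y ℤ.+ f z′) (ℤ.+-comm (f y) (f u))
          (ℤ.+-monoʳ-< (f y) (proj₂ (∈-filter⁻ above-u? {xs = neighbours y} z′∈))))

    sums! : Unique (Su ++ Sy)
    sums! = Unique.++⁺
      (Unique.map⁺ (f-inj ∘ ∙-cancelˡ (f u) _ _) (neighbours! u))
      (Unique.map⁺ (f-inj ∘ ∙-cancelˡ (f y) _ _) (Unique.filter⁺ above-u? (neighbours! y)))
      (λ (a∈ , a∈′) → ℤ.<⇒≢ (Su<Sy a∈ a∈′) refl)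

    sums⊆L : Su ++ Sy ⊆ L
    sums⊆L a∈ = Equivalence.from (L⇔σ _) (Sum.[ from-u , from-y ] (∈-++⁻ Su a∈))
      where
      from-u : ∀ {a} → a ∈ Su → a ∈σ[ G , f ]
      from-u a∈ with z , z∈ , refl ← ∈-map⁻ _ a∈ = u , z , ∈-neighbours⁻ z∈ , refl
      from-y : ∀ {a} → a ∈ Sy → a ∈σ[ G , f ]
      from-y a∈ with z , z∈ , refl ← ∈-map⁻ _ a∈ =
        y , z , ∈-neighbours⁻ (proj₁ (∈-filter⁻ above-u? {xs = neighbours y} z∈)) , refl

  ∃adjacent-degree+degree≤1+sumSetSize : (f : V G → ℤ) → Injective _≡_ _≡_ f →
    V G → (∀ v → ∃ (Adj G v)) →
    ∀ {m} → SumSetSize G f m → ∃₂ λ u y → Adj G u y × degree u + degree y ≤ suc m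
  ∃adjacent-degree+degree≤1+sumSetSize f f-inj v₀ neighbour |σ|≡m =
    u , y , u~y , degree+degree≤1+sumSetSize f f-inj |σ|≡m u-min y-max
    where
    u = Extrema.argmin f v₀ vertices
    u-min : ∀ v → f u ℤ.≤ f v
    u-min v = All.lookup (Extrema.f[argmin]≤f[xs] {f = f} v₀ vertices) (∈-vertices v)
    w₀ = proj₁ (neighbour u)
    y = Extrema.argmax f w₀ (neighbours u)
    u~y : Adj G u y
    u~y = Extrema.argmax-all f (proj₂ (neighbour u)) (All.all-filter (Adj? u) vertices)
    y-max : ∀ {v} → Adj G u v → f v ℤ.≤ f y
    y-max u~v =
      All.lookup (Extrema.f[xs]≤f[argmax] {f = f} w₀ (neighbours u)) (∈-neighbours⁺ u~v)

  ∃sumSetSize≤ : (g : V G → ℕ) (lo s : ℕ) →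
    (∀ {v w} → Adj G v w → lo ≤ g v + g w × g v + g w < lo + s) →
    ∃ λ m → m ≤ s × SumSetSize G (ℤ.+_ ∘ g) m
  ∃sumSetSize≤ g lo s edge-sum∈ =
    length L , |L|≤s , L , Unique.filter⁺ (_∈σ? f) (interval! lo s) , refl , λ z →
    mk⇔ (proj₂ ∘ ∈-filter⁻ (_∈σ? f) {xs = interval lo s})
        (λ z∈σ → ∈-filter⁺ (_∈σ? f) (σ⊆interval z∈σ) z∈σ)
    where
    f = ℤ.+_ ∘ g
    L = filter (_∈σ? f) (interval lo s)
    |L|≤s : length L ≤ s
    |L|≤s = subst (length L ≤_) (length-interval lo s) (List.length-filter (_∈σ? f) (interval lo s))
    σ⊆interval : ∀ {z} → z ∈σ[ G , f ] → z ∈ interval lo s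
    σ⊆interval (v , w , v~w , refl) =
      let lo≤x , x<lo+s = edge-sum∈ v~w in ∈-interval⁺ lo≤x x<lo+s

offset : ∀ {k} → (Fin k → ℕ) → Fin k → ℕ
offset n zero = 0
offset n (suc i) = n zero + offset (n ∘ suc) i

totalSize-suc : ∀ k (n : Fin (suc k) → ℕ) → totalSize (suc k) n ≡ n zero + totalSize k (n ∘ suc)
totalSize-suc k n = cong (λ xs → n zero + sum xs)
  (trans (List.map-tabulate suc n) (sym (List.map-tabulate id (n ∘ suc))))

offset+size≤totalSize : ∀ {k} (n : Fin k → ℕ) i → offset n i + n i ≤ totalSize k n
offset+size≤totalSize {suc k} n zero =
  subst (n zero ≤_) (sym (totalSize-suc k n)) (m≤m+n (n zero) _)
offset+size≤totalSize {suc k} n (suc i) = begin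
  n zero + offset (n ∘ suc) i + n (suc i)   ≡⟨ +-assoc (n zero) _ _ ⟩
  n zero + (offset (n ∘ suc) i + n (suc i)) ≤⟨ +-monoʳ-≤ (n zero) (offset+size≤totalSize (n ∘ suc) i) ⟩
  n zero + totalSize k (n ∘ suc)            ≡⟨ totalSize-suc k n ⟨
  totalSize (suc k) n                       ∎
  where open ≤-Reasoning

offset-separated : ∀ {k} (n : Fin k → ℕ) {i j} → i ≢ j →
                   offset n i + n i ≤ offset n j ⊎ offset n j + n j ≤ offset n i
offset-separated n {zero} {zero} i≢j = contradiction refl i≢j
offset-separated n {zero} {suc j} _ = inj₁ (m≤m+n (n zero) _)
offset-separated n {suc i} {zero} _ = inj₂ (m≤m+n (n zero) _)
offset-separated n {suc i} {suc j} i≢j =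
  Sum.map shift shift (offset-separated (n ∘ suc) (i≢j ∘ cong suc))
  where
  shift : ∀ {x y z} → x + y ≤ z → n zero + x + y ≤ n zero + z
  shift {x} {y} le = ≤-trans (≤-reflexive (+-assoc (n zero) x y)) (+-monoʳ-≤ (n zero) le)

module CompleteMultipartite (k : ℕ) (n : Fin k → ℕ) where

  Vertex : Set
  Vertex = V (completeMultipartite k n)

  part : Vertex → Fin k
  part = proj₁

  block : Fin k → List Vertex
  block i = map (i ,_) (allFin (n i))

  ∈-block⁺ : ∀ v → v ∈ block (part v)
  ∈-block⁺ (i , a) = ∈-map⁺ (i ,_) (∈-allFin a)

  ∈-block⁻ : ∀ {i v} → v ∈ block i → part v ≡ i
  ∈-block⁻ v∈ with _ , _ , refl ← ∈-map⁻ _ v∈ = refl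

  block! : ∀ i → Unique (block i)
  block! i = Unique.map⁺ (λ { refl → refl }) (Unique.allFin⁺ (n i))

  length-block : ∀ i → length (block i) ≡ n i
  length-block i = trans (List.length-map _ (allFin (n i))) (List.length-tabulate id)

  vertices : List Vertex
  vertices = concatMap block (allFin k)

  ∈-vertices : ∀ v → v ∈ vertices
  ∈-vertices v = ∈-concat⁺′ (∈-block⁺ v) (∈-map⁺ block (∈-allFin (part v)))

  vertices! : Unique vertices
  vertices! = Unique.concat⁺ (All.map⁺ (All.universal block! (allFin k)))
    (AllPairs.map⁺ (AllPairs.map blocks-disjoint (Unique.allFin⁺ k)))
    where
    blocks-disjoint : ∀ {i j} → i ≢ j → Disjoint (block i) (block j)
    blocks-disjoint i≢j (v∈i , v∈j) = i≢j (trans (sym (∈-block⁻ v∈i)) (∈-block⁻ v∈j))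

  length-vertices : length vertices ≡ totalSize k n
  length-vertices = begin
    length vertices                       ≡⟨ length-concat (map block (allFin k)) ⟩
    sum (map length (map block (allFin k))) ≡⟨ cong sum (List.map-∘ (allFin k)) ⟨
    sum (map (length ∘ block) (allFin k)) ≡⟨ cong sum (List.map-cong length-block (allFin k)) ⟩
    totalSize k n                         ∎
    where open ≡-Reasoning

  open FiniteGraph (completeMultipartite k n) vertices ∈-vertices vertices!
                   (λ v w → ¬? (part v Fin.≟ part w)) public

  totalSize≤degree+size : ∀ v → totalSize k n ≤ degree v + n (part v)
  totalSize≤degree+size v = begin
    totalSize k n                      ≡⟨ length-vertices ⟨
    length vertices                    ≤⟨ length≤length-filter+length _ vertices! same-part⊆block ⟩
    degree v + length (block (part v)) ≡⟨ cong (degree v +_) (length-block (part v)) ⟩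
    degree v + n (part v)              ∎
    where
    open ≤-Reasoning
    same-part⊆block : ∀ {w} → w ∈ vertices → ¬ (part v ≢ part w) → w ∈ block (part v)
    same-part⊆block {w} _ ¬v≢w =
      subst (λ i → w ∈ block i) (sym (decidable-stable (part v Fin.≟ part w) ¬v≢w)) (∈-block⁺ w)

  label : (Fin k → ℕ) → Vertex → ℕ
  label base (i , a) = base i + toℕ a

  base≤label : ∀ base v → base (part v) ≤ label base v
  base≤label base (i , a) = m≤m+n (base i) (toℕ a)

  label<base+size : ∀ base v → label base v < base (part v) + n (part v)
  label<base+size base (i , a) = +-monoʳ-< (base i) (Fin.toℕ<n a)

  label-injective : ∀ base → (∀ {i j} → i ≢ j → base i + n i ≤ base j ⊎ base j + n j ≤ base i) →
                    Injective _≡_ _≡_ (label base)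
  label-injective base separated {i , a} {j , b} eq with i Fin.≟ j
  ... | yes refl = cong (i ,_) (Fin.toℕ-injective (+-cancelˡ-≡ (base i) _ _ eq))
  ... | no i≢j =
    ⊥-elim (Sum.[ below (i , a) (j , b) eq , below (j , b) (i , a) (sym eq) ] (separated i≢j))
    where
    below : ∀ v w → label base v ≡ label base w → base (part v) + n (part v) ≤ base (part w) → ⊥
    below v w eq le =
      <-irrefl eq (<-≤-trans (label<base+size base v) (≤-trans le (base≤label base w)))

  module _ (g : Vertex → ℕ) {v w : Vertex} (v≢w : part v ≢ part w) where

    edge-sum-lower : ∀ {a b p} → (∀ x → a ≤ g x) → (∀ x → part x ≢ p → a + b ≤ g x) →
                     a + (a + b) ≤ g v + g w
    edge-sum-lower {a} {b} {p} low low-off-p with part v Fin.≟ p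
    ... | yes refl = +-mono-≤ (low v) (low-off-p w (v≢w ∘ sym))
    ... | no v≢p =
      subst (_≤ g v + g w) (+-comm (a + b) a) (+-mono-≤ (low-off-p v v≢p) (low w))

    edge-sum-upper : ∀ {c d q} → (∀ x → g x < c) → (∀ x → part x ≢ q → g x < d) →
                     suc (g v) + suc (g w) ≤ c + d
    edge-sum-upper {c} {d} {q} high high-off-q with part v Fin.≟ q
    ... | yes refl = +-mono-≤ (high v) (high-off-q w (v≢w ∘ sym))
    ... | no v≢q =
      subst (suc (g v) + suc (g w) ≤_) (+-comm d c) (+-mono-≤ (high-off-q v v≢q) (high w))

size+size≤n₀+n₁ : ∀ {m} (n : Fin (2 + m) → ℕ) → (∀ i j → i ≤ᶠ j → n j ≤ n i) →
                  ∀ {i j} → i ≢ j → n i + n j ≤ n zero + n (suc zero)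
size+size≤n₀+n₁ n mono {zero} {zero} i≢j = contradiction refl i≢j
size+size≤n₀+n₁ n mono {zero} {suc j} _ = +-monoʳ-≤ (n zero) (mono (suc zero) (suc j) (s≤s z≤n))
size+size≤n₀+n₁ n mono {suc i} {zero} _ =
  subst (_≤ n zero + n (suc zero)) (+-comm (n zero) (n (suc i)))
    (+-monoʳ-≤ (n zero) (mono (suc zero) (suc i) (s≤s z≤n)))
size+size≤n₀+n₁ n mono {suc i} {suc j} _ =
  +-mono-≤ (≤-trans (mono (suc zero) (suc i) (s≤s z≤n)) (mono zero (suc zero) z≤n))
           (mono (suc zero) (suc j) (s≤s z≤n))

module SumIndexOfCompleteMultipartite (m : ℕ) (n : Fin (2 + m) → ℕ) (pos : ∀ i → 0 < n i) where

  open CompleteMultipartite (2 + m) n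

  N n₀ n₁ s : ℕ
  N = totalSize (2 + m) n
  n₀ = n zero
  n₁ = n (suc zero)
  s = 2 * N ∸ n₀ ∸ n₁ ∸ 1

  n₀≤N : n₀ ≤ N
  n₀≤N = offset+size≤totalSize n zero

  n₀+n₁≤N : n₀ + n₁ ≤ N
  n₀+n₁≤N = subst (λ x → x + n₁ ≤ N) (+-identityʳ n₀) (offset+size≤totalSize n (suc zero))

  N+N≡n₀+[n₁+suc[s]] : N + N ≡ n₀ + (n₁ + suc s)
  N+N≡n₀+[n₁+suc[s]] =
    sym (trans (a+[b+suc[m∸a∸b∸1]]≡m n₀ n₁ n₀+[n₁+1]≤2N) (cong (N +_) (+-identityʳ N)))
    where
    n₀+[n₁+1]≤2N : n₀ + (n₁ + 1) ≤ 2 * N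
    n₀+[n₁+1]≤2N = subst₂ _≤_ (+-assoc n₀ n₁ 1) (cong (N +_) (sym (+-identityʳ N)))
                     (+-mono-≤ n₀+n₁≤N (≤-trans (pos zero) n₀≤N))

  has-neighbour : ∀ v → ∃ (Adj (completeMultipartite (2 + m) n) v)
  has-neighbour (zero , _) = (suc zero , fromℕ< (pos (suc zero))) , λ ()
  has-neighbour (suc _ , _) = (zero , fromℕ< (pos zero)) , λ ()

  s≤sumSetSize : (∀ i j → i ≤ᶠ j → n j ≤ n i) → ∀ f → Injective _≡_ _≡_ f →
                 ∀ l → SumSetSize (completeMultipartite (2 + m) n) f l → s ≤ l
  s≤sumSetSize mono f f-inj l |σ|≡l
    with u , y , u~y , deg≤ ← ∃adjacent-degree+degree≤1+sumSetSize f f-inj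
                                 (zero , fromℕ< (pos zero)) has-neighbour |σ|≡l =
    s≤s⁻¹ (+-cancelˡ-≤ n₁ _ _ (+-cancelˡ-≤ n₀ _ _ (begin
      n₀ + (n₁ + suc s)                                  ≡⟨ N+N≡n₀+[n₁+suc[s]] ⟨
      N + N                                              ≤⟨ +-mono-≤ (totalSize≤degree+size u)
                                                                      (totalSize≤degree+size y) ⟩
      degree u + n (part u) + (degree y + n (part y))    ≡⟨ rearrange (degree u) (n (part u))
                                                                      (degree y) (n (part y)) ⟩
      n (part u) + n (part y) + (degree u + degree y)    ≤⟨ +-mono-≤ (size+size≤n₀+n₁ n mono u~y) deg≤ ⟩
      n₀ + n₁ + suc l                                    ≡⟨ +-assoc n₀ n₁ (suc l) ⟩
      n₀ + (n₁ + suc l)                                  ∎)))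
    where
    open ≤-Reasoning
    rearrange : ∀ a p b q → a + p + (b + q) ≡ p + q + (a + b)
    rearrange = solve-∀

  base : Fin (2 + m) → ℕ
  base zero = N
  base (suc i) = offset n (suc i)

  base-separated : ∀ {i j} → i ≢ j → base i + n i ≤ base j ⊎ base j + n j ≤ base i
  base-separated {zero} {zero} i≢j = contradiction refl i≢j
  base-separated {zero} {suc j} _ = inj₂ (offset+size≤totalSize n (suc j))
  base-separated {suc i} {zero} _ = inj₁ (offset+size≤totalSize n (suc i))
  base-separated {suc i} {suc j} i≢j = offset-separated n i≢j

  g : Vertex → ℕ
  g = label base

  +g-injective : Injective _≡_ _≡_ (ℤ.+_ ∘ g)
  +g-injective = label-injective base base-separated ∘ ℤ.+-injective

  n₀≤g : ∀ v → n₀ ≤ g v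
  n₀≤g v@(zero , _) = ≤-trans n₀≤N (base≤label base v)
  n₀≤g v@(suc _ , _) = ≤-trans (m≤m+n n₀ _) (base≤label base v)

  n₀+n₁≤g : ∀ v → part v ≢ suc zero → n₀ + n₁ ≤ g v
  n₀+n₁≤g v@(zero , _) _ = ≤-trans n₀+n₁≤N (base≤label base v)
  n₀+n₁≤g (suc zero , _) v≢1 = contradiction refl v≢1
  n₀+n₁≤g v@(suc (suc _) , _) _ = ≤-trans (+-monoʳ-≤ n₀ (m≤m+n n₁ _)) (base≤label base v)

  g<N : ∀ v → part v ≢ zero → g v < N
  g<N (zero , _) v≢0 = contradiction refl v≢0
  g<N v@(suc i , _) _ = <-≤-trans (label<base+size base v) (offset+size≤totalSize n (suc i))

  g<N+n₀ : ∀ v → g v < N + n₀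
  g<N+n₀ v@(zero , _) = label<base+size base v
  g<N+n₀ v@(suc _ , _) = <-≤-trans (g<N v λ ()) (m≤m+n N n₀)

  ∃sumSetSize≤s : ∃ λ l → l ≤ s × SumSetSize (completeMultipartite (2 + m) n) (ℤ.+_ ∘ g) l
  ∃sumSetSize≤s =
    ∃sumSetSize≤ g (n₀ + (n₀ + n₁)) s λ v~w → edge-sum-lower g v~w n₀≤g n₀+n₁≤g , upper v~w
    where
    upper : ∀ {v w} → part v ≢ part w → g v + g w < n₀ + (n₀ + n₁) + s
    upper {v} {w} v~w = s≤s⁻¹ (begin
      suc (suc (g v + g w))        ≡⟨ cong suc (+-suc (g v) (g w)) ⟨
      suc (g v) + suc (g w)        ≤⟨ edge-sum-upper g v~w g<N+n₀ g<N ⟩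
      N + n₀ + N                   ≡⟨ +-comm (N + n₀) N ⟩
      N + (N + n₀)                 ≡⟨ +-assoc N N n₀ ⟨
      N + N + n₀                   ≡⟨ cong (_+ n₀) N+N≡n₀+[n₁+suc[s]] ⟩
      n₀ + (n₁ + suc s) + n₀       ≡⟨ rearrange n₀ n₁ s ⟩
      suc (n₀ + (n₀ + n₁) + s)     ∎)
      where
      open ≤-Reasoning
      rearrange : ∀ a b c → a + (b + suc c) + a ≡ suc (a + (a + b) + c)
      rearrange = solve-∀

theorem2p1 : (m : ℕ) → (n : Fin (2 + m) → ℕ)
    → (∀ i → 0 < n i)
    → (∀ i j → i ≤ᶠ j → n j ≤ n i)
    → SumIndexIs (completeMultipartite (2 + m) n)
    (2 * totalSize (2 + m) n ∸ n zero ∸ n (suc zero) ∸ 1)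
theorem2p1 m n pos mono =
  let l , l≤s , |σ|≡l = ∃sumSetSize≤s
  in SumIndexIs-intro {completeMultipartite (2 + m) n} (ℤ.+_ ∘ g) +g-injective
                      l≤s |σ|≡l (s≤sumSetSize mono)
  where open SumIndexOfCompleteMultipartite m n pos
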